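{- For all positive integers $\Delta$ and $k\geq 3$ there is $n_0$ such that for all $n\geq n_0$ the following holds. Let $G$ be an abelian group of order $n$ and let $d=(d_1,\dots,d_k)\in\{ -\Delta,\dots,-1\}^k$ with $d_i\not\equiv 0\pmod G$ for every $i$. Then there exists a simple $x\in G^k$ such that $x\ast d$ is simple.
   Context: For an integer $d$, $d\equiv 0\pmod G$ means $d\cdot g=0$ for all $g\in G$ (equivalently, writing $G\cong\mathbb{Z}_{m_1}\times\dots\times\mathbb{Z}_{m_t}$ with prime powers $m_i$, $m_i\mid d$ for all $i$). A sequence is simple if its terms are distinct; a multiset is simple if every element has multiplicity at most $1$. For $x\in G^k$, $x\ast d$ is the multiset $\{x_i+x_j:1\leq i<j\leq k\}\cup\{d_1x_1+\dots+d_kx_k\}$. -}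

module Defs where

open import Level using (Level)
open import Algebra.Bundles using (AbelianGroup)
open import Data.Nat using (ℕ; zero; suc)
open import Data.Integer using (ℤ; +_; -[1+_])
open import Data.Fin using (Fin)
open import Relation.Binary.PropositionalEquality using () renaming (setoid to ≡-setoid)
open import Data.Product using (_×_)
open import Relation.Binary.PropositionalEquality using (_≡_)
open import Relation.Nullary using (¬_)
open import Function.Bundles using (Bijection)
import Algebra.Definitions.RawMonoid as RM

module _ {c ℓ : Level} (G : AbelianGroup c ℓ) where
  open AbelianGroup G

  private module M = RM rawMonoid

  -- integer multiple d · g  (group written multiplicatively in the bundle: _∙_, ε, _⁻¹)
  _·_ : ℤ → Carrier → Carrier
  (+ n) · g = n M.× g
  -[1+ n ] · g = (suc n M.× g) ⁻¹

  HasOrder : ℕ → Set _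
  HasOrder n = Bijection (≡-setoid (Fin n)) setoid

  ZeroModG : ℤ → Set _
  ZeroModG d = ∀ g → (d · g) ≈ ε

  SimpleSeq : ∀ {k} → (Fin k → Carrier) → Set _
  SimpleSeq x = ∀ i j → x i ≈ x j → i ≡ j

  dSum : ∀ {k} → (Fin k → ℤ) → (Fin k → Carrier) → Carrier
  dSum d x = M.sum (λ i → d i · x i)

  -- x ∗ d = {x_i + x_j : i < j} ∪ {d₁x₁+…+d_kx_k} is simple (all multiplicities ≤ 1):
  -- distinct index pairs give distinct sums, and no pair sum equals dSum.
  SimpleStar : ∀ {k} → (Fin k → Carrier) → (Fin k → ℤ) → Set _
  SimpleStar {k} x d =
    (∀ (i j i' j' : Fin k) → i Data.Fin.< j → i' Data.Fin.< j' →
       (x i ∙ x j) ≈ (x i' ∙ x j') → (i ≡ i' × j ≡ j'))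
    × (∀ (i j : Fin k) → i Data.Fin.< j → ¬ ((x i ∙ x j) ≈ dSum d x))

{-# OPTIONS --safe #-}
-- Count bad points of Gᵏ (enumerated through the bijection with Fin n): those with
-- xᵢ = xⱼ, with xᵢ + xⱼ = xᵢ′ + xⱼ′ for distinct pairs, or with xᵢ + xⱼ = d₁x₁ + … + dₖxₖ.
-- In each such event one coordinate is pinned down by the others up to the kernel of an
-- endomorphism: the identity, x ↦ dₗx, or x ↦ (dᵢ − 1)x. So an event holds at n^(k−1)·|ker|
-- points at most. Since dₗ ≢ 0 we have |ker dₗ| ≤ n/2, and ker dₗ ∩ ker (dₗ − 1) = 0 gives
-- |ker dₗ|·|ker (dₗ − 1)| ≤ n. Hence, with M = 8k² and n ≥ M², all pairs {i, j} but at most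
-- one admit a kernel of size ≤ n/M, and the remaining one a kernel of size ≤ n/2.
-- Altogether fewer than nᵏ points are bad.
module Submission where

open import Level using (Level; _⊔_)
open import Algebra.Bundles using (AbelianGroup)
import Algebra.Properties.AbelianGroup as AbelianGroupProperties
import Algebra.Properties.CommutativeMonoid.Sum as CommutativeMonoidSum
import Algebra.Properties.Monoid.Mult as MonoidMultiplication
import Algebra.Properties.CommutativeMonoid.Mult as CommutativeMonoidMultiplication
open import Algebra.Properties.CommutativeSemigroup using (interchange)
open import Data.Nat using (ℕ; zero; suc; _+_; _*_; _^_; _/_; _≤_; _<_; _≤?_; _<?_; z≤n; s≤s; NonZero; >-nonZero)
open import Data.Nat.DivMod using (m*n/n≡m; /-monoˡ-≤; m/n*n≤m)
open import Data.Nat.Tactic.RingSolver using (solve-∀)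
open import Data.Nat.Properties
open import Data.Integer as ℤ using (ℤ; -_; +_) renaming (_≤_ to _≤ℤ_)
open import Data.Fin using (Fin; zero; suc; punchIn; punchOut) renaming (_<_ to _<ᶠ_)
import Data.Fin.Properties as Finₚ
open import Data.Fin.Permutation using (Permutation; permutation)
open import Data.Vec using (Vec; []; _∷_; lookup; insertAt)
open import Data.Vec.Properties using (insertAt-lookup; insertAt-punchIn)
open import Data.Product using (Σ; ∃; _×_; _,_; proj₁; proj₂; map₂)
open import Data.Sum using (_⊎_; inj₁; inj₂; [_,_]′)
open import Data.Empty using (⊥; ⊥-elim)
open import Function using (_∘_)
open import Function.Bundles using (Bijection)
open import Relation.Nullary using (¬_; Dec; yes; no)
open import Relation.Nullary.Decidable using (_×-dec_; ¬?; decidable-stable)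
open import Relation.Unary using (Pred; Decidable)
open import Relation.Binary.Definitions using (Tri; tri<; tri≈; tri>)
import Relation.Binary.Reasoning.Setoid as SetoidReasoning
open import Relation.Binary.PropositionalEquality as ≡ using (_≡_; _≢_; module ≡-Reasoning)
open import Algebra.Properties.Semiring.Sum +-*-semiring
  using (sum; sum-syntax; sum-cong-≗; sum-permute; ∑-comm; ∑-distrib-+; *-distribˡ-sum; *-distribʳ-sum)
open import Defs

private variable
  p q : Level
  P : Set p
  Q : Set q
  n : ℕ

𝟙 : Dec P → ℕ
𝟙 (yes _) = 1
𝟙 (no _)  = 0

𝟙≤1 : (P? : Dec P) → 𝟙 P? ≤ 1
𝟙≤1 (yes _) = ≤-refl
𝟙≤1 (no _)  = z≤n

𝟙-mono : (P → Q) → (P? : Dec P) (Q? : Dec Q) → 𝟙 P? ≤ 𝟙 Q?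
𝟙-mono P⇒Q (yes _) (yes _) = ≤-refl
𝟙-mono P⇒Q (yes p) (no ¬q) = ⊥-elim (¬q (P⇒Q p))
𝟙-mono P⇒Q (no _)  _       = z≤n

𝟙-cong : (P → Q) → (Q → P) → (P? : Dec P) (Q? : Dec Q) → 𝟙 P? ≡ 𝟙 Q?
𝟙-cong P⇒Q Q⇒P P? Q? = ≤-antisym (𝟙-mono P⇒Q P? Q?) (𝟙-mono Q⇒P Q? P?)

𝟙-no : ¬ P → (P? : Dec P) → 𝟙 P? ≡ 0
𝟙-no ¬p (yes p) = ⊥-elim (¬p p)
𝟙-no ¬p (no _)  = ≡.refl

𝟙≡0⇒¬ : (P? : Dec P) → 𝟙 P? ≡ 0 → ¬ P
𝟙≡0⇒¬ (no ¬p) _ = ¬p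

𝟙-× : (P? : Dec P) (Q? : Dec Q) → 𝟙 (P? ×-dec Q?) ≡ 𝟙 P? * 𝟙 Q?
𝟙-× (yes _) (yes _) = ≡.refl
𝟙-× (yes _) (no _)  = ≡.refl
𝟙-× (no _)  _       = ≡.refl

𝟙-disjoint : (P → Q → ⊥) → (P? : Dec P) (Q? : Dec Q) → 𝟙 P? + 𝟙 Q? ≤ 1
𝟙-disjoint P⇒¬Q (yes p) (yes q) = ⊥-elim (P⇒¬Q p q)
𝟙-disjoint P⇒¬Q (yes _) (no _)  = ≤-refl
𝟙-disjoint P⇒¬Q (no _)  Q?      = 𝟙≤1 Q?

sum-mono-≤ : {f g : Fin n → ℕ} → (∀ i → f i ≤ g i) → sum f ≤ sum g
sum-mono-≤ {zero}  f≤g = z≤n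
sum-mono-≤ {suc n} f≤g = +-mono-≤ (f≤g zero) (sum-mono-≤ (f≤g ∘ suc))

sum-const : ∀ n c → ∑[ i < n ] c ≡ n * c
sum-const zero    c = ≡.refl
sum-const (suc n) c = ≡.cong (_+_ c) (sum-const n c)

sum≡0⇒≡0 : (f : Fin n → ℕ) → sum f ≡ 0 → ∀ i → f i ≡ 0
sum≡0⇒≡0 f ∑f≡0 zero    = m+n≡0⇒m≡0 (f zero) ∑f≡0
sum≡0⇒≡0 f ∑f≡0 (suc i) = sum≡0⇒≡0 (f ∘ suc) (m+n≡0⇒n≡0 (f zero) ∑f≡0) i

sum-<⇒∃< : (f g : Fin n → ℕ) → sum f < sum g → ∃ λ i → f i < g i
sum-<⇒∃< {suc n} f g ∑f<∑g with f zero <? g zero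
... | yes f₀<g₀ = zero , f₀<g₀
... | no  f₀≮g₀ with sum-<⇒∃< (f ∘ suc) (g ∘ suc)
                       (+-cancelˡ-< (g zero) _ _ (≤-<-trans (+-monoˡ-≤ _ (≮⇒≥ f₀≮g₀)) ∑f<∑g))
...   | i , fᵢ<gᵢ = suc i , fᵢ<gᵢ

sum-≤-one-exception : ∀ {f : Fin n → ℕ} L s → (∀ i → f i ≤ L) →
  (∀ i j → i ≢ j → f i ≤ s ⊎ f j ≤ s) → sum f ≤ L + n * s
sum-≤-one-exception {zero}          L s f≤L one = z≤n
sum-≤-one-exception {suc n} {f} L s f≤L one with f zero ≤? s
... | yes f₀≤s = begin
  f zero + sum (f ∘ suc) ≤⟨ +-mono-≤ f₀≤s (sum-≤-one-exception L s (f≤L ∘ suc) one∘suc) ⟩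
  s + (L + n * s)        ≡⟨ +-comm s _ ⟩
  L + n * s + s          ≡⟨ +-assoc L _ s ⟩
  L + (n * s + s)        ≡⟨ ≡.cong (_+_ L) (+-comm (n * s) s) ⟩
  L + suc n * s          ∎
  where
  open ≤-Reasoning
  one∘suc : ∀ i j → i ≢ j → f (suc i) ≤ s ⊎ f (suc j) ≤ s
  one∘suc i j i≢j = one (suc i) (suc j) (i≢j ∘ Finₚ.suc-injective)
... | no f₀≰s = begin
  f zero + sum (f ∘ suc) ≤⟨ +-mono-≤ (f≤L zero) (sum-mono-≤ rest≤s) ⟩
  L + ∑[ i < n ] s       ≡⟨ ≡.cong (_+_ L) (sum-const n s) ⟩
  L + n * s              ≤⟨ +-monoʳ-≤ L (m≤n+m (n * s) s) ⟩
  L + suc n * s          ∎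
  where
  open ≤-Reasoning
  rest≤s : ∀ i → f (suc i) ≤ s
  rest≤s i with one zero (suc i) (λ ())
  ... | inj₁ f₀≤s = ⊥-elim (f₀≰s f₀≤s)
  ... | inj₂ fᵢ≤s = fᵢ≤s

∑∑-≤-one-exception : ∀ {m} {f : Fin m → Fin n → ℕ} L s → (∀ i j → f i j ≤ L) →
  (∀ i j i′ j′ → ¬ (i ≡ i′ × j ≡ j′) → f i j ≤ s ⊎ f i′ j′ ≤ s) →
  ∑[ i < m ] ∑[ j < n ] f i j ≤ (L + n * s) + m * (n * s)
∑∑-≤-one-exception {n} {m} {f} L s f≤L one =
  sum-≤-one-exception (L + n * s) (n * s) row≤ rows
  where
  row≤ : ∀ i → sum (f i) ≤ L + n * s
  row≤ i = sum-≤-one-exception L s (f≤L i) (λ j j′ j≢j′ → one i j i j′ (j≢j′ ∘ proj₂))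
  small-row : ∀ i → (∀ j → f i j ≤ s) → sum (f i) ≤ n * s
  small-row i fᵢ≤s = ≤-trans (sum-mono-≤ fᵢ≤s) (≤-reflexive (sum-const n s))
  rows : ∀ i i′ → i ≢ i′ → sum (f i) ≤ n * s ⊎ sum (f i′) ≤ n * s
  rows i i′ i≢i′ with Finₚ.all? (λ j → f i j ≤? s)
  ... | yes fᵢ≤s = inj₁ (small-row i fᵢ≤s)
  ... | no ¬fᵢ≤s with Finₚ.¬∀⟶∃¬ n _ (λ j → f i j ≤? s) ¬fᵢ≤s
  ...   | j , fᵢⱼ≰s = inj₂ (small-row i′ fᵢ′≤s)
    where
    fᵢ′≤s : ∀ j′ → f i′ j′ ≤ s
    fᵢ′≤s j′ with one i j i′ j′ (i≢i′ ∘ proj₁)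
    ... | inj₁ fᵢⱼ≤s  = ⊥-elim (fᵢⱼ≰s fᵢⱼ≤s)
    ... | inj₂ fᵢ′ⱼ′≤s = fᵢ′ⱼ′≤s

∑∑-const : ∀ p q c → ∑[ i < p ] ∑[ j < q ] c ≡ p * (q * c)
∑∑-const p q c = ≡.trans (sum-cong-≗ {p} (λ _ → sum-const q c)) (sum-const p (q * c))

count : {P : Pred (Fin n) p} → Decidable P → ℕ
count {n} P? = ∑[ a < n ] 𝟙 (P? a)

count-none : {P : Pred (Fin n) p} (P? : Decidable P) → (∀ a → ¬ P a) → count P? ≡ 0
count-none {zero}  P? none = ≡.refl
count-none {suc n} P? none = ≡.cong₂ _+_ (𝟙-no (none zero) (P? zero)) (count-none (P? ∘ suc) (none ∘ suc))

count-≤1 : {P : Pred (Fin n) p} (P? : Decidable P) → (∀ a b → P a → P b → a ≡ b) → count P? ≤ 1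
count-≤1 {zero}  P? unique = z≤n
count-≤1 {suc n} P? unique with P? zero
... | yes P₀ = ≤-reflexive (≡.cong suc (count-none (P? ∘ suc) (λ a Pₐ → 0≢suc (unique zero (suc a) P₀ Pₐ))))
  where
  0≢suc : ∀ {a : Fin n} → zero ≢ suc a
  0≢suc ()
... | no _   = count-≤1 (P? ∘ suc) (λ a b Pₐ P_b → Finₚ.suc-injective (unique (suc a) (suc b) Pₐ P_b))

module _ {n : ℕ} where

  ∑ᵛ : ∀ k → (Vec (Fin n) k → ℕ) → ℕ
  ∑ᵛ zero    F = F []
  ∑ᵛ (suc k) F = ∑[ a < n ] ∑ᵛ k (λ y → F (a ∷ y))

  ∑ᵛ-mono-≤ : ∀ k {F G : Vec (Fin n) k → ℕ} → (∀ x → F x ≤ G x) → ∑ᵛ k F ≤ ∑ᵛ k G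
  ∑ᵛ-mono-≤ zero    F≤G = F≤G []
  ∑ᵛ-mono-≤ (suc k) F≤G = sum-mono-≤ (λ a → ∑ᵛ-mono-≤ k (λ y → F≤G (a ∷ y)))

  ∑ᵛ-const : ∀ k c → ∑ᵛ k (λ _ → c) ≡ n ^ k * c
  ∑ᵛ-const zero    c = ≡.sym (+-identityʳ c)
  ∑ᵛ-const (suc k) c = begin
    ∑[ a < n ] ∑ᵛ k (λ _ → c) ≡⟨ sum-cong-≗ {n} (λ _ → ∑ᵛ-const k c) ⟩
    ∑[ a < n ] (n ^ k * c)    ≡⟨ sum-const n (n ^ k * c) ⟩
    n * (n ^ k * c)           ≡⟨ *-assoc n (n ^ k) c ⟨
    n ^ suc k * c             ∎
    where open ≡-Reasoning

  ∑ᵛ-distrib-+ : ∀ k (F G : Vec (Fin n) k → ℕ) → ∑ᵛ k (λ x → F x + G x) ≡ ∑ᵛ k F + ∑ᵛ k G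
  ∑ᵛ-distrib-+ zero    F G = ≡.refl
  ∑ᵛ-distrib-+ (suc k) F G =
    ≡.trans (sum-cong-≗ {n} (λ a → ∑ᵛ-distrib-+ k (λ y → F (a ∷ y)) (λ y → G (a ∷ y))))
          (∑-distrib-+ (λ a → ∑ᵛ k (λ y → F (a ∷ y))) (λ a → ∑ᵛ k (λ y → G (a ∷ y))))

  ∑ᵛ-comm-∑ : ∀ k {m} (F : Fin m → Vec (Fin n) k → ℕ) →
    ∑ᵛ k (λ x → ∑[ e < m ] F e x) ≡ ∑[ e < m ] ∑ᵛ k (F e)
  ∑ᵛ-comm-∑ zero    F = ≡.refl
  ∑ᵛ-comm-∑ (suc k) F =
    ≡.trans (sum-cong-≗ {n} (λ a → ∑ᵛ-comm-∑ k (λ e y → F e (a ∷ y))))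
          (∑-comm (λ a e → ∑ᵛ k (λ y → F e (a ∷ y))))

  ∑ᵛ-insertAt : ∀ k (i : Fin (suc k)) (F : Vec (Fin n) (suc k) → ℕ) →
    ∑ᵛ (suc k) F ≡ ∑ᵛ k (λ y → ∑[ a < n ] F (insertAt y i a))
  ∑ᵛ-insertAt k       zero    F = ≡.sym (∑ᵛ-comm-∑ k (λ a y → F (a ∷ y)))
  ∑ᵛ-insertAt (suc k) (suc i) F = sum-cong-≗ {n} (λ b → ∑ᵛ-insertAt k i (λ x → F (b ∷ x)))

  ∑ᵛ-<⇒∃< : ∀ k (F G : Vec (Fin n) k → ℕ) → ∑ᵛ k F < ∑ᵛ k G → ∃ λ x → F x < G x
  ∑ᵛ-<⇒∃< zero    F G F<G = [] , F<G
  ∑ᵛ-<⇒∃< (suc k) F G ∑F<∑G with sum-<⇒∃< _ _ ∑F<∑G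
  ... | a , ∑Fₐ<∑Gₐ with ∑ᵛ-<⇒∃< k _ _ ∑Fₐ<∑Gₐ
  ...   | y , F<G = a ∷ y , F<G

  ∑ᵛ-𝟙-empty : ∀ k {e} {E : Pred (Vec (Fin n) k) e} (E? : Decidable E) → (∀ x → ¬ E x) →
    ∑ᵛ k (λ x → 𝟙 (E? x)) ≡ 0
  ∑ᵛ-𝟙-empty k E? none = n≤0⇒n≡0 (begin
    ∑ᵛ k (λ x → 𝟙 (E? x)) ≤⟨ ∑ᵛ-mono-≤ k (λ x → ≤-reflexive (𝟙-no (none x) (E? x))) ⟩
    ∑ᵛ k (λ _ → 0)        ≡⟨ ∑ᵛ-const k 0 ⟩
    n ^ k * 0             ≡⟨ *-zeroʳ (n ^ k) ⟩
    0                     ∎)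
    where open ≤-Reasoning

  ∑ᵛ-∑∑-≤ : ∀ k {p q} (F : Fin p → Fin q → Vec (Fin n) k → ℕ) B (c : Fin p → Fin q → ℕ) →
    (∀ i j → ∑ᵛ k (F i j) ≤ B * c i j) →
    ∑ᵛ k (λ x → ∑[ i < p ] ∑[ j < q ] F i j x) ≤ B * ∑[ i < p ] ∑[ j < q ] c i j
  ∑ᵛ-∑∑-≤ k {p} {q} F B c F≤Bc = begin
    ∑ᵛ k (λ x → ∑[ i < p ] ∑[ j < q ] F i j x) ≡⟨ ∑ᵛ-comm-∑ k (λ i x → ∑[ j < q ] F i j x) ⟩
    ∑[ i < p ] ∑ᵛ k (λ x → ∑[ j < q ] F i j x) ≡⟨ sum-cong-≗ {p} (λ i → ∑ᵛ-comm-∑ k (F i)) ⟩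
    ∑[ i < p ] ∑[ j < q ] ∑ᵛ k (F i j)         ≤⟨ sum-mono-≤ (λ i → sum-mono-≤ (F≤Bc i)) ⟩
    ∑[ i < p ] ∑[ j < q ] (B * c i j)          ≡⟨ sum-cong-≗ {p} (λ i → *-distribˡ-sum B (c i)) ⟨
    ∑[ i < p ] (B * ∑[ j < q ] c i j)          ≡⟨ *-distribˡ-sum B (λ i → ∑[ j < q ] c i j) ⟨
    B * ∑[ i < p ] ∑[ j < q ] c i j            ∎
    where open ≤-Reasoning

*≤⇒≤/ : ∀ q {c n} .{{_ : NonZero q}} → q * c ≤ n → c ≤ n / q
*≤⇒≤/ q {c} {n} qc≤n = begin
  c              ≡⟨ m*n/n≡m c q ⟨
  c * q / q      ≤⟨ /-monoˡ-≤ q (≤-trans (≤-reflexive (*-comm c q)) qc≤n) ⟩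
  n / q          ∎
  where open ≤-Reasoning

m*n≤m*[m*n] : ∀ m n → m * n ≤ m * (m * n)
m*n≤m*[m*n] zero        n = z≤n
m*n≤m*[m*n] m@(suc _) n = *-monoʳ-≤ m (m≤n*m n m)

-- A accounts for the coincidences of pairs, L for the exceptional pair and s for every other pair.
total-bound : ∀ k n A L s → 4 * A < n → 2 * L ≤ n → 8 * (k * k) * s ≤ n →
  A + ((L + k * s) + k * (k * s)) < n
total-bound k n A L s 4A<n 2L≤n 8k²s≤n = *-cancelˡ-< 4 _ _ (begin-strict
  4 * (A + ((L + k * s) + k * (k * s)))             ≡⟨ distribute A L (k * s) (k * (k * s)) ⟩
  4 * A + 2 * (2 * L) + 4 * (k * s + k * (k * s))   <⟨ +-mono-<-≤ (+-mono-<-≤ 4A<n (*-monoʳ-≤ 2 2L≤n)) s-part ⟩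
  n + 2 * n + n                                     ≡⟨ collect n ⟩
  4 * n                                             ∎)
  where
  open ≤-Reasoning
  distribute : ∀ A L x y → 4 * (A + ((L + x) + y)) ≡ 4 * A + 2 * (2 * L) + 4 * (x + y)
  distribute = solve-∀
  collect : ∀ n → n + 2 * n + n ≡ 4 * n
  collect = solve-∀
  double : ∀ k s → 4 * (k * (k * s) + k * (k * s)) ≡ 8 * (k * k) * s
  double = solve-∀
  s-part : 4 * (k * s + k * (k * s)) ≤ n
  s-part = begin
    4 * (k * s + k * (k * s))           ≤⟨ *-monoʳ-≤ 4 (+-monoˡ-≤ _ (m*n≤m*[m*n] k s)) ⟩
    4 * (k * (k * s) + k * (k * s))     ≡⟨ double k s ⟩
    8 * (k * k) * s                     ≤⟨ 8k²s≤n ⟩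
    n                                   ∎

third : ∀ {m} (i j : Fin (3 + m)) → ∃ λ l → l ≢ i × l ≢ j
third zero          zero          = suc zero , (λ ()) , (λ ())
third zero          (suc zero)    = suc (suc zero) , (λ ()) , (λ ())
third zero          (suc (suc j)) = suc zero , (λ ()) , (λ ())
third (suc zero)    zero          = suc (suc zero) , (λ ()) , (λ ())
third (suc zero)    (suc _)       = zero , (λ ()) , (λ ())
third (suc (suc i)) zero          = suc zero , (λ ()) , (λ ())
third (suc (suc i)) (suc _)       = zero , (λ ()) , (λ ())

fresh-endpoint : ∀ {k} {i j i′ j′ : Fin k} → i <ᶠ j → i′ <ᶠ j′ → ¬ (i ≡ i′ × j ≡ j′) →
  (i ≢ i′ × i ≢ j′) ⊎ (j ≢ i′ × j ≢ j′)
fresh-endpoint {i = i} {j} {i′} {j′} i<j i′<j′ ≢pair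
  with i Finₚ.≟ i′ | i Finₚ.≟ j′ | j Finₚ.≟ i′ | j Finₚ.≟ j′
... | no i≢i′   | no i≢j′   | _          | _          = inj₁ (i≢i′ , i≢j′)
... | _         | _         | no j≢i′    | no j≢j′    = inj₂ (j≢i′ , j≢j′)
... | yes i≡i′  | _         | yes j≡i′   | _          = ⊥-elim (Finₚ.<⇒≢ i<j (≡.trans i≡i′ (≡.sym j≡i′)))
... | yes i≡i′  | _         | _          | yes j≡j′   = ⊥-elim (≢pair (i≡i′ , j≡j′))
... | _         | yes i≡j′  | yes j≡i′   | _          = ⊥-elim (Finₚ.<-asym i<j (≡.subst₂ _<ᶠ_ (≡.sym j≡i′) (≡.sym i≡j′) i′<j′))
... | _         | yes i≡j′  | _          | yes j≡j′   = ⊥-elim (Finₚ.<⇒≢ i<j (≡.trans i≡j′ (≡.sym j≡j′)))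

module _ {c ℓ} (G : AbelianGroup c ℓ) where

  open AbelianGroup G
  open AbelianGroupProperties G using (x≈z//y; xyx⁻¹≈y)
  open import Algebra.Properties.CommutativeSemigroup commutativeSemigroup using (xy∙z≈xz∙y)

  x∙y≈z∙w⇒z-x≈y-w : ∀ {x y z w} → x ∙ y ≈ z ∙ w → z - x ≈ y - w
  x∙y≈z∙w⇒z-x≈y-w {x} {y} {z} {w} xy≈zw = x≈z//y _ _ _ (begin
    (z - x) ∙ w   ≈⟨ xy∙z≈xz∙y z (x ⁻¹) w ⟩
    (z ∙ w) - x   ≈⟨ ∙-congʳ xy≈zw ⟨
    (x ∙ y) - x   ≈⟨ xyx⁻¹≈y x y ⟩
    y             ∎)
    where open SetoidReasoning setoid

module FiniteAbelianGroup {c ℓ} (G : AbelianGroup c ℓ) {n : ℕ} (order : HasOrder G n) where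

  open AbelianGroup G
  open AbelianGroupProperties G
  open MonoidMultiplication monoid using (×-congʳ)
  open CommutativeMonoidMultiplication commutativeMonoid using (×-distrib-+)
  open Bijection order public using (to)
  open Bijection order using (to⁻; injective; strictlySurjective)
  module ≈-Reasoning = SetoidReasoning setoid

  to∘to⁻ : ∀ y → to (to⁻ y) ≈ y
  to∘to⁻ y = proj₂ (strictlySurjective y)

  infix 4 _≈?_
  _≈?_ : ∀ x y → Dec (x ≈ y)
  x ≈? y with to⁻ x Finₚ.≟ to⁻ y
  ... | yes eq = yes (begin
    x          ≈⟨ to∘to⁻ x ⟨
    to (to⁻ x) ≡⟨ ≡.cong to eq ⟩
    to (to⁻ y) ≈⟨ to∘to⁻ y ⟩
    y          ∎)
    where open ≈-Reasoning
  ... | no neq = no (λ x≈y → neq (injective (trans (to∘to⁻ x) (trans x≈y (sym (to∘to⁻ y))))))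

  translation : Carrier → Permutation n n
  translation g = permutation (shift g) (shift (g ⁻¹))
    (shift-inverse g (g ⁻¹) (inverseˡ g)) (shift-inverse (g ⁻¹) g (inverseʳ g))
    where
    shift : Carrier → Fin n → Fin n
    shift g a = to⁻ (to a ∙ g)
    shift-inverse : ∀ g h → h ∙ g ≈ ε → ∀ a → shift g (shift h a) ≡ a
    shift-inverse g h h∙g≈ε a = injective (begin
      to (to⁻ (to (to⁻ (to a ∙ h)) ∙ g)) ≈⟨ to∘to⁻ _ ⟩
      to (to⁻ (to a ∙ h)) ∙ g            ≈⟨ ∙-congʳ (to∘to⁻ _) ⟩
      to a ∙ h ∙ g                       ≈⟨ assoc _ _ _ ⟩
      to a ∙ (h ∙ g)                     ≈⟨ ∙-congˡ h∙g≈ε ⟩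
      to a ∙ ε                           ≈⟨ identityʳ _ ⟩
      to a                               ∎)
      where open ≈-Reasoning

  sum-translate : (φ : Carrier → ℕ) → (∀ {x y} → x ≈ y → φ x ≡ φ y) → ∀ g →
    ∑[ a < n ] φ (to a) ≡ ∑[ a < n ] φ (to a ∙ g)
  sum-translate φ φ-cong g =
    ≡.trans (sum-permute (φ ∘ to) (translation g)) (sum-cong-≗ {n} (λ a → φ-cong (to∘to⁻ _)))

  record Endo : Set (c ⊔ ℓ) where
    field
      ⟦_⟧     : Carrier → Carrier
      ⟦⟧-cong : ∀ {x y} → x ≈ y → ⟦_⟧ x ≈ ⟦_⟧ y
      ⟦⟧-homo : ∀ x y → ⟦_⟧ (x ∙ y) ≈ ⟦_⟧ x ∙ ⟦_⟧ y

    ⟦x⟧≈⟦y⟧⇒⟦x-y⟧≈ε : ∀ x y → ⟦_⟧ x ≈ ⟦_⟧ y → ⟦_⟧ (x - y) ≈ ε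
    ⟦x⟧≈⟦y⟧⇒⟦x-y⟧≈ε x y eq = identityˡ-unique _ _ (begin
      ⟦_⟧ (x - y) ∙ ⟦_⟧ y  ≈⟨ ⟦⟧-homo _ _ ⟨
      ⟦_⟧ ((x - y) ∙ y)    ≈⟨ ⟦⟧-cong (//-rightDividesˡ y x) ⟩
      ⟦_⟧ x                ≈⟨ eq ⟩
      ⟦_⟧ y                ∎)
      where open ≈-Reasoning

  open Endo public

  #fiber : Endo → Carrier → ℕ
  #fiber h t = count (λ a → ⟦ h ⟧ (to a) ≈? t)

  #ker : Endo → ℕ
  #ker h = #fiber h ε

  #fiber≡#ker : ∀ h {g t} → ⟦ h ⟧ g ≈ t → #fiber h t ≡ #ker h
  #fiber≡#ker h {g} {t} hg≈t = begin
    #fiber h t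
      ≡⟨ sum-translate (λ y → 𝟙 (⟦ h ⟧ y ≈? t)) φ-cong g ⟩
    ∑[ a < n ] 𝟙 (⟦ h ⟧ (to a ∙ g) ≈? t)
      ≡⟨ sum-cong-≗ {n} (λ a → 𝟙-cong (shifted⇒ker (to a)) (ker⇒shifted (to a)) _ _) ⟩
    #ker h
      ∎
    where
    open ≡-Reasoning
    φ-cong : ∀ {x y} → x ≈ y → 𝟙 (⟦ h ⟧ x ≈? t) ≡ 𝟙 (⟦ h ⟧ y ≈? t)
    φ-cong x≈y = 𝟙-cong (trans (⟦⟧-cong h (sym x≈y))) (trans (⟦⟧-cong h x≈y)) _ _
    shifted⇒ker : ∀ u → ⟦ h ⟧ (u ∙ g) ≈ t → ⟦ h ⟧ u ≈ ε
    shifted⇒ker u eq = identityˡ-unique _ _ (trans (∙-congˡ (sym hg≈t)) (trans (sym (⟦⟧-homo h u g)) eq))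
    ker⇒shifted : ∀ u → ⟦ h ⟧ u ≈ ε → ⟦ h ⟧ (u ∙ g) ≈ t
    ker⇒shifted u eq = trans (⟦⟧-homo h u g) (trans (∙-cong eq hg≈t) (identityˡ t))

  #fiber≤#ker : ∀ h t → #fiber h t ≤ #ker h
  #fiber≤#ker h t with Finₚ.any? (λ a → ⟦ h ⟧ (to a) ≈? t)
  ... | yes (a , eq) = ≤-reflexive (#fiber≡#ker h eq)
  ... | no ∄a = ≤-trans (≤-reflexive (count-none _ (λ a eq → ∄a (a , eq)))) z≤n

  #ker≤1 : ∀ h → (∀ u → ⟦ h ⟧ u ≈ ε → u ≈ ε) → #ker h ≤ 1
  #ker≤1 h injective-h = count-≤1 _ (λ a b a∈ker b∈ker →
    injective (trans (injective-h _ a∈ker) (sym (injective-h _ b∈ker))))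

  2*#ker≤n : ∀ h g → ¬ ⟦ h ⟧ g ≈ ε → 2 * #ker h ≤ n
  2*#ker≤n h g hg≉ε = begin
    2 * #ker h                                    ≡⟨ ≡.cong (_+_ (#ker h)) (+-identityʳ _) ⟩
    #ker h + #ker h                               ≡⟨ ≡.cong (_+_ (#ker h)) (#fiber≡#ker h refl) ⟨
    #ker h + #fiber h (⟦ h ⟧ g)                   ≡⟨ ∑-distrib-+ (𝟙 ∘ ker?) (𝟙 ∘ fiber?) ⟨
    ∑[ a < n ] (𝟙 (ker? a) + 𝟙 (fiber? a))        ≤⟨ sum-mono-≤ (λ a → 𝟙-disjoint disjoint (ker? a) (fiber? a)) ⟩
    ∑[ a < n ] 1                                  ≡⟨ sum-const n 1 ⟩
    n * 1                                         ≡⟨ *-identityʳ n ⟩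
    n                                             ∎
    where
    open ≤-Reasoning
    ker? fiber? : ∀ a → Dec _
    ker? a = ⟦ h ⟧ (to a) ≈? ε
    fiber? a = ⟦ h ⟧ (to a) ≈? ⟦ h ⟧ g
    disjoint : ∀ {u} → u ≈ ε → u ≈ ⟦ h ⟧ g → ⊥
    disjoint u≈ε u≈hg = hg≉ε (trans (sym u≈hg) u≈ε)

  #ker*#ker≤n : ∀ h₁ h₂ → (∀ u → ⟦ h₁ ⟧ u ≈ ε → ⟦ h₂ ⟧ u ≈ ε → u ≈ ε) → #ker h₁ * #ker h₂ ≤ n
  #ker*#ker≤n h₁ h₂ trivial = begin
    #ker h₁ * #ker h₂
      ≡⟨ *-distribʳ-sum (#ker h₂) (𝟙 ∘ ker₁?) ⟩
    ∑[ a < n ] (𝟙 (ker₁? a) * #ker h₂)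
      ≡⟨ sum-cong-≗ {n} (λ a → ≡.cong (𝟙 (ker₁? a) *_) (#fiber≡#ker h₂ refl)) ⟨
    ∑[ a < n ] (𝟙 (ker₁? a) * #fiber h₂ (⟦ h₂ ⟧ (to a)))
      ≡⟨ sum-cong-≗ {n} (λ a → *-distribˡ-sum (𝟙 (ker₁? a)) (𝟙 ∘ fiber₂? a)) ⟩
    ∑[ a < n ] ∑[ b < n ] (𝟙 (ker₁? a) * 𝟙 (fiber₂? a b))
      ≡⟨ sum-cong-≗ {n} (λ a → sum-cong-≗ {n} (λ b → 𝟙-× (ker₁? a) (fiber₂? a b))) ⟨
    ∑[ a < n ] ∑[ b < n ] 𝟙 (ker₁? a ×-dec fiber₂? a b)
      ≡⟨ ∑-comm (λ a b → 𝟙 (ker₁? a ×-dec fiber₂? a b)) ⟩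
    ∑[ b < n ] count (λ a → ker₁? a ×-dec fiber₂? a b)
      ≤⟨ sum-mono-≤ (λ b → count-≤1 _ (λ a a′ → unique b)) ⟩
    ∑[ b < n ] 1
      ≡⟨ sum-const n 1 ⟩
    n * 1
      ≡⟨ *-identityʳ n ⟩
    n
      ∎
    where
    open ≤-Reasoning
    ker₁? : ∀ a → Dec _
    ker₁? a = ⟦ h₁ ⟧ (to a) ≈? ε
    fiber₂? : ∀ a b → Dec _
    fiber₂? a b = ⟦ h₂ ⟧ (to b) ≈? ⟦ h₂ ⟧ (to a)
    unique : ∀ b {a a′} → ⟦ h₁ ⟧ (to a) ≈ ε × ⟦ h₂ ⟧ (to b) ≈ ⟦ h₂ ⟧ (to a) →
      ⟦ h₁ ⟧ (to a′) ≈ ε × ⟦ h₂ ⟧ (to b) ≈ ⟦ h₂ ⟧ (to a′) → a ≡ a′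
    unique b (a∈ker₁ , ba) (a′∈ker₁ , ba′) = injective (x∙y⁻¹≈ε⇒x≈y _ _ (trivial _
      (⟦x⟧≈⟦y⟧⇒⟦x-y⟧≈ε h₁ _ _ (trans a∈ker₁ (sym a′∈ker₁)))
      (⟦x⟧≈⟦y⟧⇒⟦x-y⟧≈ε h₂ _ _ (trans (sym ba) ba′))))

  idᴱ : Endo
  idᴱ = record { ⟦_⟧ = λ x → x ; ⟦⟧-cong = λ x≈y → x≈y ; ⟦⟧-homo = λ _ _ → refl }

  infixr 8 _·ᴳ_
  _·ᴳ_ : ℤ → Carrier → Carrier
  _·ᴳ_ = _·_ G

  ·-cong : ∀ z {x y} → x ≈ y → z ·ᴳ x ≈ z ·ᴳ y
  ·-cong (ℤ.+ m)    x≈y = ×-congʳ m x≈y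
  ·-cong ℤ.-[1+ m ] x≈y = ⁻¹-cong (×-congʳ (suc m) x≈y)

  ·-homo : ∀ z x y → z ·ᴳ (x ∙ y) ≈ z ·ᴳ x ∙ z ·ᴳ y
  ·-homo (ℤ.+ m)    x y = ×-distrib-+ x y m
  ·-homo ℤ.-[1+ m ] x y = trans (⁻¹-cong (×-distrib-+ x y (suc m))) (sym (⁻¹-∙-comm _ _))

  mul : ℤ → Endo
  mul z = record { ⟦_⟧ = z ·ᴳ_ ; ⟦⟧-cong = ·-cong z ; ⟦⟧-homo = ·-homo z }

  mulMinusId : ℤ → Endo
  mulMinusId z = record
    { ⟦_⟧     = λ x → z ·ᴳ x - x
    ; ⟦⟧-cong = λ x≈y → ∙-cong (·-cong z x≈y) (⁻¹-cong x≈y)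
    ; ⟦⟧-homo = λ x y → trans (∙-cong (·-homo z x y) (sym (⁻¹-∙-comm x y)))
                               (interchange commutativeSemigroup _ _ _ _)
    }

  #ker-mul*#ker-mulMinusId≤n : ∀ z → #ker (mul z) * #ker (mulMinusId z) ≤ n
  #ker-mul*#ker-mulMinusId≤n z = #ker*#ker≤n (mul z) (mulMinusId z) trivial
    where
    trivial : ∀ u → z ·ᴳ u ≈ ε → z ·ᴳ u - u ≈ ε → u ≈ ε
    trivial u zu≈ε zu-u≈ε = ⁻¹-injective (begin
      u ⁻¹         ≈⟨ identityˡ _ ⟨
      ε ∙ u ⁻¹     ≈⟨ ∙-congʳ zu≈ε ⟨
      z ·ᴳ u - u   ≈⟨ zu-u≈ε ⟩
      ε            ≈⟨ ε⁻¹≈ε ⟨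
      ε ⁻¹         ∎)
      where open ≈-Reasoning

  2*#ker-mul≤n : ∀ z → ¬ ZeroModG G z → 2 * #ker (mul z) ≤ n
  2*#ker-mul≤n z z≢0 with Finₚ.all? (λ a → z ·ᴳ to a ≈? ε)
  ... | yes z·≈ε = ⊥-elim (z≢0 (λ g → trans (·-cong z (sym (to∘to⁻ g))) (z·≈ε (to⁻ g))))
  ... | no ¬z·≈ε with Finₚ.¬∀⟶∃¬ n _ (λ a → z ·ᴳ to a ≈? ε) ¬z·≈ε
  ...   | a , za≉ε = 2*#ker≤n (mul z) (to a) za≉ε

  toᵛ : ∀ {k} → Vec (Fin n) k → Fin k → Carrier
  toᵛ x i = to (lookup x i)

  toᵛ-insertAt-self : ∀ {k} (y : Vec (Fin n) k) i a → toᵛ (insertAt y i a) i ≡ to a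
  toᵛ-insertAt-self y i a = ≡.cong to (insertAt-lookup y i a)

  toᵛ-insertAt-other : ∀ {k} (y : Vec (Fin n) k) {i j} a (i≢j : i ≢ j) →
    toᵛ (insertAt y i a) j ≡ toᵛ y (punchOut i≢j)
  toᵛ-insertAt-other y {i} {j} a i≢j = ≡.cong to (begin
    lookup (insertAt y i a) j                           ≡⟨ ≡.cong (lookup (insertAt y i a)) (Finₚ.punchIn-punchOut i≢j) ⟨
    lookup (insertAt y i a) (punchIn i (punchOut i≢j))  ≡⟨ insertAt-punchIn y i a (punchOut i≢j) ⟩
    lookup y (punchOut i≢j)                             ∎)
    where open ≡-Reasoning

  count-by-fiber : ∀ {k e} {E : Pred (Vec (Fin n) (suc k)) e} (E? : Decidable E) i h (forced : Vec (Fin n) k → Carrier) →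
    (∀ y a → E (insertAt y i a) → ⟦ h ⟧ (to a) ≈ forced y) → ∑ᵛ (suc k) (λ x → 𝟙 (E? x)) ≤ n ^ k * #ker h
  count-by-fiber {k} E? i h forced on-fiber = begin
    ∑ᵛ (suc k) (λ x → 𝟙 (E? x))                       ≡⟨ ∑ᵛ-insertAt k i (λ x → 𝟙 (E? x)) ⟩
    ∑ᵛ k (λ y → ∑[ a < n ] 𝟙 (E? (insertAt y i a)))  ≤⟨ ∑ᵛ-mono-≤ k (λ y → sum-mono-≤ (λ a → 𝟙-mono (on-fiber y a) _ _)) ⟩
    ∑ᵛ k (λ y → #fiber h (forced y))                  ≤⟨ ∑ᵛ-mono-≤ k (λ y → #fiber≤#ker h (forced y)) ⟩
    ∑ᵛ k (λ _ → #ker h)                               ≡⟨ ∑ᵛ-const k (#ker h) ⟩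
    n ^ k * #ker h                                    ∎
    where open ≤-Reasoning

  count-determined : ∀ {k e} {E : Pred (Vec (Fin n) (suc k)) e} (E? : Decidable E) i (forced : Vec (Fin n) k → Carrier) →
    (∀ y a → E (insertAt y i a) → to a ≈ forced y) → ∑ᵛ (suc k) (λ x → 𝟙 (E? x)) ≤ n ^ k
  count-determined {k} E? i forced determined = begin
    ∑ᵛ (suc k) (λ x → 𝟙 (E? x)) ≤⟨ count-by-fiber E? i idᴱ forced determined ⟩
    n ^ k * #ker idᴱ            ≤⟨ *-monoʳ-≤ (n ^ k) (#ker≤1 idᴱ (λ _ u≈ε → u≈ε)) ⟩
    n ^ k * 1                   ≡⟨ *-identityʳ (n ^ k) ⟩
    n ^ k                       ∎
    where open ≤-Reasoning

  count-pair-determined : ∀ {k e} {E : Pred (Vec (Fin n) (suc k)) e} (E? : Decidable E) {i p r s} →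
    (i≢p : i ≢ p) (i≢r : i ≢ r) (i≢s : i ≢ s) →
    (∀ x → E x → toᵛ x i ∙ toᵛ x p ≈ toᵛ x r ∙ toᵛ x s) → ∑ᵛ (suc k) (λ x → 𝟙 (E? x)) ≤ n ^ k
  count-pair-determined {k} {E = E} E? {i} {p} {r} {s} i≢p i≢r i≢s sums≈ = count-determined E? i forced determined
    where
    forced : Vec (Fin n) k → Carrier
    forced y = (toᵛ y (punchOut i≢r) ∙ toᵛ y (punchOut i≢s)) - toᵛ y (punchOut i≢p)
    determined : ∀ y a → E (insertAt y i a) → to a ≈ forced y
    determined y a e = begin
      to a                            ≡⟨ toᵛ-insertAt-self y i a ⟨
      toᵛ x i                         ≈⟨ x≈z//y _ _ _ (sums≈ x e) ⟩
      (toᵛ x r ∙ toᵛ x s) - toᵛ x p   ≡⟨ ≡.cong₂ _-_ (≡.cong₂ _∙_ (other i≢r) (other i≢s)) (other i≢p) ⟩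
      forced y                        ∎
      where
      open ≈-Reasoning
      x = insertAt y i a
      other : ∀ {j} (i≢j : i ≢ j) → toᵛ x j ≡ toᵛ y (punchOut i≢j)
      other = toᵛ-insertAt-other y a

module Constants (k : ℕ) where

  M W n₀ : ℕ
  M = 8 * (k * k)
  W = 1 + k * k
  n₀ = M * M + suc (4 * (k * (k * W)))

module Construction {c ℓ} (G : AbelianGroup c ℓ) {n : ℕ} (order : HasOrder G n) (m : ℕ)
  (d : Fin (3 + m) → ℤ) (d≢0 : ∀ i → ¬ ZeroModG G (d i)) (n₀≤n : Constants.n₀ (3 + m) ≤ n) where

  open AbelianGroup G
  open AbelianGroupProperties G using (x≈z//y)
  open FiniteAbelianGroup G order
  module ∑ᴳ = CommutativeMonoidSum commutativeMonoid

  k k′ : ℕ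
  k = 3 + m
  k′ = 2 + m

  Point : Set
  Point = Vec (Fin n) k

  Collision : Fin k → Fin k → Point → Set ℓ
  Collision i j x = i <ᶠ j × toᵛ x i ≈ toᵛ x j

  SumCollision : Fin k → Fin k → Fin k → Fin k → Point → Set ℓ
  SumCollision i j i′ j′ x =
    i <ᶠ j × i′ <ᶠ j′ × ¬ (i ≡ i′ × j ≡ j′) × toᵛ x i ∙ toᵛ x j ≈ toᵛ x i′ ∙ toᵛ x j′

  DSumHit : Fin k → Fin k → Point → Set ℓ
  DSumHit i j x = i <ᶠ j × toᵛ x i ∙ toᵛ x j ≈ dSum G d (toᵛ x)

  collision? : ∀ i j → Decidable (Collision i j)
  collision? i j x = i Finₚ.<? j ×-dec toᵛ x i ≈? toᵛ x j

  sumCollision? : ∀ i j i′ j′ → Decidable (SumCollision i j i′ j′)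
  sumCollision? i j i′ j′ x = i Finₚ.<? j ×-dec i′ Finₚ.<? j′ ×-dec
    ¬? (i Finₚ.≟ i′ ×-dec j Finₚ.≟ j′) ×-dec toᵛ x i ∙ toᵛ x j ≈? toᵛ x i′ ∙ toᵛ x j′

  dSumHit? : ∀ i j → Decidable (DSumHit i j)
  dSumHit? i j x = i Finₚ.<? j ×-dec toᵛ x i ∙ toᵛ x j ≈? dSum G d (toᵛ x)

  count-impossible : ∀ {e} {E : Pred Point e} (E? : Decidable E) → (∀ x → ¬ E x) → ∀ b →
    ∑ᵛ k (λ x → 𝟙 (E? x)) ≤ b
  count-impossible E? none b = ≤-trans (≤-reflexive (∑ᵛ-𝟙-empty k E? none)) z≤n

  count-assuming : ∀ {e p} {E : Pred Point e} {P : Set p} (E? : Decidable E) → Dec P → (∀ x → E x → P) →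
    ∀ {b} → (P → ∑ᵛ k (λ x → 𝟙 (E? x)) ≤ b) → ∑ᵛ k (λ x → 𝟙 (E? x)) ≤ b
  count-assuming E? (yes p) _         bound = bound p
  count-assuming E? (no ¬p) necessary _     = count-impossible E? (λ x e → ¬p (necessary x e)) _

  #Collision≤ : ∀ i j → ∑ᵛ k (λ x → 𝟙 (collision? i j x)) ≤ n ^ k′
  #Collision≤ i j = count-assuming (collision? i j) (i Finₚ.<? j) (λ _ → proj₁) λ i<j →
    let i≢j = Finₚ.<⇒≢ i<j in
    count-determined (collision? i j) i (λ y → toᵛ y (punchOut i≢j)) λ y a (_ , xᵢ≈xⱼ) → begin
      to a                    ≡⟨ toᵛ-insertAt-self y i a ⟨
      toᵛ (insertAt y i a) i  ≈⟨ xᵢ≈xⱼ ⟩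
      toᵛ (insertAt y i a) j  ≡⟨ toᵛ-insertAt-other y a i≢j ⟩
      toᵛ y (punchOut i≢j)    ∎
    where open ≈-Reasoning

  #SumCollision≤ : ∀ i j i′ j′ → ∑ᵛ k (λ x → 𝟙 (sumCollision? i j i′ j′ x)) ≤ n ^ k′
  #SumCollision≤ i j i′ j′ =
    count-assuming (sumCollision? i j i′ j′)
      (i Finₚ.<? j ×-dec i′ Finₚ.<? j′ ×-dec ¬? (i Finₚ.≟ i′ ×-dec j Finₚ.≟ j′))
      (λ _ (i<j , i′<j′ , ≢pair , _) → i<j , i′<j′ , ≢pair)
      λ (i<j , i′<j′ , ≢pair) → [ fresh-i i<j , fresh-j i<j ]′ (fresh-endpoint i<j i′<j′ ≢pair)
    where
    fresh-i : i <ᶠ j → i ≢ i′ × i ≢ j′ → ∑ᵛ k (λ x → 𝟙 (sumCollision? i j i′ j′ x)) ≤ n ^ k′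
    fresh-i i<j (i≢i′ , i≢j′) =
      count-pair-determined (sumCollision? i j i′ j′) (Finₚ.<⇒≢ i<j) i≢i′ i≢j′ (λ _ (_ , _ , _ , sums≈) → sums≈)
    fresh-j : i <ᶠ j → j ≢ i′ × j ≢ j′ → ∑ᵛ k (λ x → 𝟙 (sumCollision? i j i′ j′ x)) ≤ n ^ k′
    fresh-j i<j (j≢i′ , j≢j′) =
      count-pair-determined (sumCollision? i j i′ j′) (Finₚ.<⇒≢ i<j ∘ ≡.sym) j≢i′ j≢j′
        (λ _ (_ , _ , _ , sums≈) → trans (comm _ _) sums≈)

  rest : Fin k → Vec (Fin n) k′ → Carrier
  rest i y = ∑ᴳ.sum (λ l → d (punchIn i l) ·ᴳ toᵛ y l)

  dSum-insertAt : ∀ y i a → dSum G d (toᵛ (insertAt y i a)) ≈ d i ·ᴳ to a ∙ rest i y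
  dSum-insertAt y i a = trans (∑ᴳ.sum-remove {i = i} (λ l → d l ·ᴳ toᵛ (insertAt y i a) l))
    (∙-cong (·-cong (d i) (reflexive (toᵛ-insertAt-self y i a)))
            (∑ᴳ.sum-cong-≋ (λ l → ·-cong (d (punchIn i l)) (reflexive (≡.cong to (insertAt-punchIn y i a l))))))

  #DSumHit≤-third : ∀ {i j l} → l ≢ i → l ≢ j →
    ∑ᵛ k (λ x → 𝟙 (dSumHit? i j x)) ≤ n ^ k′ * #ker (mul (d l))
  #DSumHit≤-third {i} {j} {l} l≢i l≢j = count-by-fiber (dSumHit? i j) l (mul (d l)) forced on-fiber
    where
    forced : Vec (Fin n) k′ → Carrier
    forced y = (toᵛ y (punchOut l≢i) ∙ toᵛ y (punchOut l≢j)) - rest l y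
    on-fiber : ∀ y a → DSumHit i j (insertAt y l a) → d l ·ᴳ to a ≈ forced y
    on-fiber y a (_ , hit) = begin
      d l ·ᴳ to a                     ≈⟨ x≈z//y _ _ _ (sym (trans hit (dSum-insertAt y l a))) ⟩
      (toᵛ x i ∙ toᵛ x j) - rest l y  ≡⟨ ≡.cong (_- rest l y) (≡.cong₂ _∙_ (toᵛ-insertAt-other y a l≢i)
                                                                         (toᵛ-insertAt-other y a l≢j)) ⟩
      forced y                        ∎
      where
      open ≈-Reasoning
      x = insertAt y l a

  #DSumHit≤-endpoint : ∀ {i j} p q → p ≢ q → (∀ x → toᵛ x i ∙ toᵛ x j ≈ toᵛ x p ∙ toᵛ x q) →
    ∑ᵛ k (λ x → 𝟙 (dSumHit? i j x)) ≤ n ^ k′ * #ker (mulMinusId (d p))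
  #DSumHit≤-endpoint {i} {j} p q p≢q ij≈pq = count-by-fiber (dSumHit? i j) p (mulMinusId (d p)) forced on-fiber
    where
    forced : Vec (Fin n) k′ → Carrier
    forced y = toᵛ y (punchOut p≢q) - rest p y
    on-fiber : ∀ y a → DSumHit i j (insertAt y p a) → d p ·ᴳ to a - to a ≈ forced y
    on-fiber y a (_ , hit) = begin
      d p ·ᴳ to a - to a   ≈⟨ x∙y≈z∙w⇒z-x≈y-w G split ⟩
      toᵛ x q - rest p y   ≡⟨ ≡.cong (_- rest p y) (toᵛ-insertAt-other y a p≢q) ⟩
      forced y             ∎
      where
      open ≈-Reasoning
      x = insertAt y p a
      split : to a ∙ toᵛ x q ≈ d p ·ᴳ to a ∙ rest p y
      split = begin
        to a ∙ toᵛ x q        ≡⟨ ≡.cong (_∙ toᵛ x q) (toᵛ-insertAt-self y p a) ⟨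
        toᵛ x p ∙ toᵛ x q     ≈⟨ ij≈pq x ⟨
        toᵛ x i ∙ toᵛ x j     ≈⟨ hit ⟩
        dSum G d (toᵛ x)      ≈⟨ dSum-insertAt y p a ⟩
        d p ·ᴳ to a ∙ rest p y ∎

  open Constants k

  M*M≤n : M * M ≤ n
  M*M≤n = ≤-trans (m≤m+n (M * M) _) n₀≤n

  4k²W<n : 4 * (k * (k * W)) < n
  4k²W<n = ≤-trans (m≤n+m _ (M * M)) n₀≤n

  instance
    n≢0 : NonZero n
    n≢0 = >-nonZero (≤-trans (s≤s z≤n) 4k²W<n)

  α β : Fin k → ℕ
  α l = #ker (mul (d l))
  β l = #ker (mulMinusId (d l))

  Big : Fin k → Set
  Big l = n < M * β l

  big? : Decidable Big
  big? l = n <? M * β l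

  big⇒M*α≤n : ∀ {l} → Big l → M * α l ≤ n
  big⇒M*α≤n {l} n<Mβ = begin
    M * α l  ≤⟨ *-monoʳ-≤ M (<⇒≤ α<M) ⟩
    M * M    ≤⟨ M*M≤n ⟩
    n        ∎
    where
    open ≤-Reasoning
    α<M : α l < M
    α<M = *-cancelʳ-< (β l) (α l) M (≤-<-trans (#ker-mul*#ker-mulMinusId≤n (d l)) n<Mβ)

  Exceptional : Fin k → Fin k → Set
  Exceptional i j = i <ᶠ j × Big i × Big j × (∀ l → l ≢ i → l ≢ j → ¬ Big l)

  exceptional-unique : ∀ {i j i′ j′} → Exceptional i j → Exceptional i′ j′ → i ≡ i′ × j ≡ j′
  exceptional-unique {i} {j} {i′} {j′} (i<j , big-i , big-j , _) (i′<j′ , _ , _ , others-small) =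
    decidable-stable (i Finₚ.≟ i′ ×-dec j Finₚ.≟ j′) λ ≢pair →
      [ (λ (i≢i′ , i≢j′) → others-small i i≢i′ i≢j′ big-i)
      , (λ (j≢i′ , j≢j′) → others-small j j≢i′ j≢j′ big-j)
      ]′ (fresh-endpoint i<j i′<j′ ≢pair)

  record PairCost (i j : Fin k) : Set where
    field
      cost                 : ℕ
      #DSumHit≤            : ∑ᵛ k (λ x → 𝟙 (dSumHit? i j x)) ≤ n ^ k′ * cost
      2*cost≤n             : 2 * cost ≤ n
      small-or-exceptional : M * cost ≤ n ⊎ Exceptional i j

  small-cost : ∀ {i j} c → ∑ᵛ k (λ x → 𝟙 (dSumHit? i j x)) ≤ n ^ k′ * c → M * c ≤ n → PairCost i j
  small-cost c bound M*c≤n = record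
    { cost                 = c
    ; #DSumHit≤            = bound
    ; 2*cost≤n             = ≤-trans (*-monoˡ-≤ c {2} {M} (s≤s (s≤s z≤n))) M*c≤n
    ; small-or-exceptional = inj₁ M*c≤n
    }

  -- Pin down xᵢ (through dᵢ − 1), xⱼ, or a third coordinate xₗ (through dₗ), whichever
  -- kernel is small.
  pairCost : ∀ i j → PairCost i j
  pairCost i j with i Finₚ.<? j
  ... | no i≮j = record
    { cost                 = 0
    ; #DSumHit≤            = count-impossible (dSumHit? i j) (λ _ (i<j , _) → i≮j i<j) _
    ; 2*cost≤n             = z≤n
    ; small-or-exceptional = inj₁ (≤-trans (≤-reflexive (*-zeroʳ M)) z≤n)
    }
  ... | yes i<j with big? i | big? j | Finₚ.any? (λ l → ¬? (l Finₚ.≟ i) ×-dec ¬? (l Finₚ.≟ j) ×-dec big? l)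
  ...   | no ¬big-i | _         | _ =
    small-cost (β i) (#DSumHit≤-endpoint i j (Finₚ.<⇒≢ i<j) (λ _ → refl)) (≮⇒≥ ¬big-i)
  ...   | yes _     | no ¬big-j | _ =
    small-cost (β j) (#DSumHit≤-endpoint j i (Finₚ.<⇒≢ i<j ∘ ≡.sym) (λ _ → comm _ _)) (≮⇒≥ ¬big-j)
  ...   | yes _     | yes _     | yes (l , l≢i , l≢j , big-l) =
    small-cost (α l) (#DSumHit≤-third l≢i l≢j) (big⇒M*α≤n big-l)
  ...   | yes big-i | yes big-j | no ∄big-l with third i j
  ...     | l , l≢i , l≢j = record
    { cost                 = α l
    ; #DSumHit≤            = #DSumHit≤-third l≢i l≢j
    ; 2*cost≤n             = 2*#ker-mul≤n (d l) (d≢0 l)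
    ; small-or-exceptional = inj₂ (i<j , big-i , big-j , λ l′ l′≢i l′≢j big-l′ → ∄big-l (l′ , l′≢i , l′≢j , big-l′))
    }

  cost : Fin k → Fin k → ℕ
  cost i j = PairCost.cost (pairCost i j)

  ∑∑cost≤ : ∑[ i < k ] ∑[ j < k ] cost i j ≤ (n / 2 + k * (n / M)) + k * (k * (n / M))
  ∑∑cost≤ = ∑∑-≤-one-exception (n / 2) (n / M) (λ i j → *≤⇒≤/ 2 (PairCost.2*cost≤n (pairCost i j))) one
    where
    one : ∀ i j i′ j′ → ¬ (i ≡ i′ × j ≡ j′) → cost i j ≤ n / M ⊎ cost i′ j′ ≤ n / M
    one i j i′ j′ ≢pair with PairCost.small-or-exceptional (pairCost i j)
                           | PairCost.small-or-exceptional (pairCost i′ j′)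
    ... | inj₁ small | _          = inj₁ (*≤⇒≤/ M small)
    ... | inj₂ _     | inj₁ small = inj₂ (*≤⇒≤/ M small)
    ... | inj₂ exc   | inj₂ exc′  = ⊥-elim (≢pair (exceptional-unique exc exc′))

  pairBadness : Fin k → Fin k → Point → ℕ
  pairBadness i j x = 𝟙 (collision? i j x)
                    + ∑[ i′ < k ] ∑[ j′ < k ] 𝟙 (sumCollision? i j i′ j′ x)
                    + 𝟙 (dSumHit? i j x)

  badness : Point → ℕ
  badness x = ∑[ i < k ] ∑[ j < k ] pairBadness i j x

  #pairBadness≤ : ∀ i j → ∑ᵛ k (pairBadness i j) ≤ n ^ k′ * (W + cost i j)
  #pairBadness≤ i j = begin
    ∑ᵛ k (pairBadness i j)
      ≡⟨ ≡.trans (∑ᵛ-distrib-+ k (λ x → 𝟙 (collision? i j x) + sumCollisions x) (λ x → 𝟙 (dSumHit? i j x)))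
                 (≡.cong (_+ ∑ᵛ k (λ x → 𝟙 (dSumHit? i j x))) (∑ᵛ-distrib-+ k (λ x → 𝟙 (collision? i j x)) sumCollisions)) ⟩
    ∑ᵛ k (λ x → 𝟙 (collision? i j x)) + ∑ᵛ k sumCollisions + ∑ᵛ k (λ x → 𝟙 (dSumHit? i j x))
      ≤⟨ +-mono-≤ (+-mono-≤ (#Collision≤ i j) #sumCollisions≤) (PairCost.#DSumHit≤ (pairCost i j)) ⟩
    n ^ k′ + n ^ k′ * (k * k) + n ^ k′ * cost i j
      ≡⟨ factor (n ^ k′) (k * k) (cost i j) ⟩
    n ^ k′ * (W + cost i j)
      ∎
    where
    open ≤-Reasoning
    sumCollisions : Point → ℕ
    sumCollisions x = ∑[ i′ < k ] ∑[ j′ < k ] 𝟙 (sumCollision? i j i′ j′ x)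
    #sumCollisions≤ : ∑ᵛ k sumCollisions ≤ n ^ k′ * (k * k)
    #sumCollisions≤ = begin
      ∑ᵛ k sumCollisions
        ≤⟨ ∑ᵛ-∑∑-≤ k (λ i′ j′ x → 𝟙 (sumCollision? i j i′ j′ x)) (n ^ k′) (λ _ _ → 1)
             (λ i′ j′ → ≤-trans (#SumCollision≤ i j i′ j′) (≤-reflexive (≡.sym (*-identityʳ _)))) ⟩
      n ^ k′ * ∑[ i′ < k ] ∑[ j′ < k ] 1
        ≡⟨ ≡.cong (n ^ k′ *_) (≡.trans (∑∑-const k k 1) (≡.cong (k *_) (*-identityʳ k))) ⟩
      n ^ k′ * (k * k)
        ∎
    factor : ∀ N K c → N + N * K + N * c ≡ N * (1 + K + c)
    factor = solve-∀

  T : ℕ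
  T = ∑[ i < k ] ∑[ j < k ] (W + cost i j)

  T<n : T < n
  T<n = begin-strict
    T
      ≡⟨ split-W ⟩
    k * (k * W) + ∑[ i < k ] ∑[ j < k ] cost i j
      ≤⟨ +-monoʳ-≤ (k * (k * W)) ∑∑cost≤ ⟩
    k * (k * W) + ((n / 2 + k * (n / M)) + k * (k * (n / M)))
      <⟨ total-bound k n (k * (k * W)) (n / 2) (n / M) 4k²W<n 2*[n/2]≤n M*[n/M]≤n ⟩
    n
      ∎
    where
    open ≤-Reasoning
    split-W : T ≡ k * (k * W) + ∑[ i < k ] ∑[ j < k ] cost i j
    split-W = begin-equality
      ∑[ i < k ] ∑[ j < k ] (W + cost i j)
        ≡⟨ sum-cong-≗ {k} (λ i → ∑-distrib-+ (λ _ → W) (cost i)) ⟩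
      ∑[ i < k ] (∑[ j < k ] W + ∑[ j < k ] cost i j)
        ≡⟨ ∑-distrib-+ (λ _ → ∑[ j < k ] W) (λ i → ∑[ j < k ] cost i j) ⟩
      ∑[ i < k ] ∑[ j < k ] W + ∑[ i < k ] ∑[ j < k ] cost i j
        ≡⟨ ≡.cong (_+ ∑[ i < k ] ∑[ j < k ] cost i j) (∑∑-const k k W) ⟩
      k * (k * W) + ∑[ i < k ] ∑[ j < k ] cost i j
        ∎
    2*[n/2]≤n : 2 * (n / 2) ≤ n
    2*[n/2]≤n = ≤-trans (≤-reflexive (*-comm 2 (n / 2))) (m/n*n≤m n 2)
    M*[n/M]≤n : M * (n / M) ≤ n
    M*[n/M]≤n = ≤-trans (≤-reflexive (*-comm M (n / M))) (m/n*n≤m n M)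

  ∑ᵛbadness<∑ᵛ1 : ∑ᵛ k badness < ∑ᵛ {n} k (λ _ → 1)
  ∑ᵛbadness<∑ᵛ1 = begin-strict
    ∑ᵛ k badness     ≤⟨ ∑ᵛ-∑∑-≤ k pairBadness (n ^ k′) (λ i j → W + cost i j) #pairBadness≤ ⟩
    n ^ k′ * T       <⟨ *-monoʳ-< (n ^ k′) {{m^n≢0 n k′}} T<n ⟩
    n ^ k′ * n       ≡⟨ *-comm (n ^ k′) n ⟩
    n ^ k            ≡⟨ *-identityʳ (n ^ k) ⟨
    n ^ k * 1        ≡⟨ ∑ᵛ-const {n} k 1 ⟨
    ∑ᵛ {n} k (λ _ → 1) ∎
    where open ≤-Reasoning

  good-point : ∃ λ x → badness x ≡ 0
  good-point = map₂ n<1⇒n≡0 (∑ᵛ-<⇒∃< k badness (λ _ → 1) ∑ᵛbadness<∑ᵛ1)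

  x₀ : Point
  x₀ = proj₁ good-point

  pairBadness≡0 : ∀ i j → pairBadness i j x₀ ≡ 0
  pairBadness≡0 i j =
    sum≡0⇒≡0 (λ j → pairBadness i j x₀) (sum≡0⇒≡0 (λ i → ∑[ j < k ] pairBadness i j x₀) (proj₂ good-point) i) j

  no-collision : ∀ i j → ¬ Collision i j x₀
  no-collision i j = 𝟙≡0⇒¬ (collision? i j x₀) (m+n≡0⇒m≡0 _ (m+n≡0⇒m≡0 _ (pairBadness≡0 i j)))

  no-sumCollision : ∀ i j i′ j′ → ¬ SumCollision i j i′ j′ x₀
  no-sumCollision i j i′ j′ = 𝟙≡0⇒¬ (sumCollision? i j i′ j′ x₀)
    (sum≡0⇒≡0 (λ j′ → 𝟙 (sumCollision? i j i′ j′ x₀)) (sum≡0⇒≡0 (λ i′ → ∑[ j′ < k ] 𝟙 (sumCollision? i j i′ j′ x₀))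
      (m+n≡0⇒n≡0 (𝟙 (collision? i j x₀)) (m+n≡0⇒m≡0 _ (pairBadness≡0 i j))) i′) j′)

  no-dSumHit : ∀ i j → ¬ DSumHit i j x₀
  no-dSumHit i j = 𝟙≡0⇒¬ (dSumHit? i j x₀) (m+n≡0⇒n≡0 _ (pairBadness≡0 i j))

  solution : Σ (Fin k → Carrier) λ x → SimpleSeq G x × SimpleStar G x d
  solution = toᵛ x₀ , simple , distinct-sums , sums≉dSum
    where
    simple : SimpleSeq G (toᵛ x₀)
    simple i j xᵢ≈xⱼ = from-trichotomy (Finₚ.<-cmp i j)
      where
      from-trichotomy : Tri (i <ᶠ j) (i ≡ j) (j <ᶠ i) → i ≡ j
      from-trichotomy (tri< i<j _ _) = ⊥-elim (no-collision i j (i<j , xᵢ≈xⱼ))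
      from-trichotomy (tri≈ _ i≡j _) = i≡j
      from-trichotomy (tri> _ _ j<i) = ⊥-elim (no-collision j i (j<i , sym xᵢ≈xⱼ))
    distinct-sums : ∀ i j i′ j′ → i <ᶠ j → i′ <ᶠ j′ → toᵛ x₀ i ∙ toᵛ x₀ j ≈ toᵛ x₀ i′ ∙ toᵛ x₀ j′ →
      i ≡ i′ × j ≡ j′
    distinct-sums i j i′ j′ i<j i′<j′ sums≈ = decidable-stable (i Finₚ.≟ i′ ×-dec j Finₚ.≟ j′)
      (λ ≢pair → no-sumCollision i j i′ j′ (i<j , i′<j′ , ≢pair , sums≈))
    sums≉dSum : ∀ i j → i <ᶠ j → ¬ toᵛ x₀ i ∙ toᵛ x₀ j ≈ dSum G d (toᵛ x₀)
    sums≉dSum i j i<j hit = no-dSumHit i j (i<j , hit)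

lemma5p3 : {c ℓ : Level} → (Δ k : ℕ) → 1 ≤ Δ → 3 ≤ k →
    Σ ℕ λ n₀ → (n : ℕ) → n₀ ≤ n →
    (G : AbelianGroup c ℓ) → HasOrder G n →
    (d : Fin k → ℤ) →
    (∀ i → (- (+ Δ)) ≤ℤ d i × d i ≤ℤ (- (+ 1))) →
    (∀ i → ¬ ZeroModG G (d i)) →
    Σ (Fin k → AbelianGroup.Carrier G) λ x → SimpleSeq G x × SimpleStar G x d
lemma5p3 Δ (suc (suc (suc m))) _ (s≤s (s≤s (s≤s _))) =
  Constants.n₀ (3 + m) , λ n n₀≤n G order d _ d≢0 → Construction.solution G order m d d≢0 n₀≤n
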